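{- Let $\lambda\in\mathbb{R}$, let $r$ be a nonnegative integer, and let $k\geq 0$ be an integer. Then $$\frac{1}{(x+r)(x+r+\lambda)\cdots(x+r+k\lambda)}=\sum_{n=k}^{\infty}(-1)^{n-k}{n+r \brace k+r}_{r,\lambda}\Big(\frac{1}{x}\Big)^{n+1},$$ where the right-hand side is the expansion of the left-hand side in powers of $1/x$.
   Context: For $\lambda\in\mathbb{R}$, $(x)_{0,\lambda}=1$ and $(x)_{n,\lambda}=x(x-\lambda)\cdots(x-(n-1)\lambda)$ for $n\ge1$. For a nonnegative integer $r$, the $\lambda$-analogues of $r$-Stirling numbers of the second kind ${n+r \brace k+r}_{r,\lambda}$ ($0\le k\le n$) are defined by $(x+r)^n=\sum_{k=0}^n{n+r \brace k+r}_{r,\lambda}(x)_{k,\lambda}$ for $n\ge0$; they are set to $0$ for $k>n$. -}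

module Defs where

open import Level using (Level)
open import Algebra.Bundles using (CommutativeRing)
open import Data.Nat using (ℕ; zero; suc; _≤?_; _∸_)
open import Data.List using (List; []; _∷_)
open import Relation.Nullary using (yes; no)
open import Data.Product using (_×_)
import Data.Nat

-- Univariate polynomials over a commutative ring R, represented by
-- coefficient lists (lowest degree first); equality is coefficientwise.
module Poly {c ℓ : Level} (R : CommutativeRing c ℓ) where
  open CommutativeRing R

  infix 4 _≈P_
  infixl 6 _+P_
  infixl 7 _*P_
  infixr 8 _^P_

  Pol : Set c
  Pol = List Carrier

  coeff : Pol → ℕ → Carrier
  coeff []       _       = 0#
  coeff (a ∷ p)  zero    = a
  coeff (a ∷ p)  (suc i) = coeff p i

  _≈P_ : Pol → Pol → Set ℓ
  p ≈P q = ∀ i → coeff p i ≈ coeff q i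

  _+P_ : Pol → Pol → Pol
  []      +P q       = q
  (a ∷ p) +P []      = a ∷ p
  (a ∷ p) +P (b ∷ q) = (a + b) ∷ (p +P q)

  scale : Carrier → Pol → Pol
  scale a []      = []
  scale a (b ∷ q) = (a * b) ∷ scale a q

  _*P_ : Pol → Pol → Pol
  []      *P q = []
  (a ∷ p) *P q = scale a q +P (0# ∷ (p *P q))

  const : Carrier → Pol
  const a = a ∷ []

  X : Pol
  X = 0# ∷ 1# ∷ []

  _^P_ : Pol → ℕ → Pol
  p ^P zero  = const 1#
  p ^P suc n = p *P (p ^P n)

  ι : ℕ → Carrier
  ι zero    = 0#
  ι (suc n) = 1# + ι n

  sgn : ℕ → Carrier
  sgn zero    = 1#
  sgn (suc m) = - sgn m

  sumTo : ℕ → (ℕ → Carrier) → Carrier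
  sumTo zero    f = 0#
  sumTo (suc n) f = sumTo n f + f n

  sumP : ℕ → (ℕ → Pol) → Pol
  sumP zero    f = []
  sumP (suc n) f = sumP n f +P f n

  prodP : ℕ → (ℕ → Pol) → Pol
  prodP zero    f = const 1#
  prodP (suc n) f = prodP n f *P f n

  fallλ : Carrier → ℕ → Pol
  fallλ lam k = prodP k (λ i → X +P const (- (ι i * lam)))

  -- S is the family of λ-analogues of r-Stirling numbers of the second kind:
  -- S n k = {n+r brace k+r}_{r,λ}, defined by
  --   (x+r)^n = Σ_{k=0}^n S n k (x)_{k,λ}   (identity in R[x]),  and 0 for k > n.
  IsLamRStirling : Carrier → ℕ → (ℕ → ℕ → Carrier) → Set ℓ
  IsLamRStirling lam r S =
    (∀ n → (X +P const (ι r)) ^P n ≈P sumP (suc n) (λ k → scale (S n k) (fallλ lam k)))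
    × (∀ n k → Data.Nat._<_ n k → S n k ≈ 0#)

  denom : Carrier → ℕ → ℕ → Pol
  denom lam r k = prodP (suc k) (λ j → X +P const (ι r + ι j * lam))

  -- coefficient of (1/x)^d in the right-hand side
  --   Σ_{n ≥ k} (-1)^{n-k} S n k (1/x)^{n+1}
  rhsCoeff : ℕ → (ℕ → ℕ → Carrier) → ℕ → Carrier
  rhsCoeff k S zero    = 0#
  rhsCoeff k S (suc n) with k ≤? n
  ... | yes _ = sgn (n ∸ k) * S n k
  ... | no  _ = 0#

  δ₀ : ℕ → Carrier
  δ₀ zero    = 1#
  δ₀ (suc _) = 0#

{-# OPTIONS --safe #-}
module Submission where

-- Put y = 1/x and F_k(y) = Σ_n (-1)^{n-k} S(n,k) y^{n+1}, F_{-1} = 1. Multiplying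
-- (x + r)^n = Σ_k S(n,k) (x)_{k,λ} by x + r and using
-- (x + r)(x)_{k,λ} = (x)_{k+1,λ} + (r + kλ)(x)_{k,λ}, uniqueness of coordinates in the
-- monic basis (x)_{k,λ} gives S(n+1,k) = S(n,k-1) + (r + kλ) S(n,k). Read on the series,
-- this recurrence says (x + r + kλ) F_k = F_{k-1}, so multiplying F_k by
-- (x + r)(x + r + λ)⋯(x + r + kλ) telescopes down to F_{-1} = 1.

open import Defs
open import Level using (Level)
open import Algebra.Bundles using (CommutativeRing)
open import Data.Nat using (ℕ; zero; suc; _<_; _<?_; _≤?_; _∸_; s≤s; z≤n) renaming (_+_ to _+ℕ_)
import Data.Nat
open import Data.Nat.Properties using (<-trans; m<n⇒m<1+n; n<1+n; ≮⇒≥; ≰⇒>; m<1+n⇒m<n∨m≡n; +-∸-assoc)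
open import Data.List using ([]; _∷_)
open import Data.Product using (proj₁; proj₂)
open import Data.Sum using (_⊎_; inj₁; inj₂)
open import Relation.Nullary using (yes; no)
open import Relation.Binary.PropositionalEquality using (_≡_)
import Relation.Binary.PropositionalEquality as ≡

module PolyProperties {c ℓ : Level} (R : CommutativeRing c ℓ) where
  open CommutativeRing R hiding (zero)
  open Poly R
  open import Relation.Binary.Reasoning.Setoid setoid
  open import Algebra.Properties.CommutativeSemigroup +-commutativeSemigroup using (interchange)
  open import Algebra.Properties.Group +-group using (∙-cancelʳ)
  open import Algebra.Solver.Ring.NaturalCoefficients.Default commutativeSemiring

  sumTo-cong : ∀ n {f g : ℕ → Carrier} → (∀ k → f k ≈ g k) → sumTo n f ≈ sumTo n g
  sumTo-cong zero    f≈g = refl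
  sumTo-cong (suc n) f≈g = +-cong (sumTo-cong n f≈g) (f≈g n)

  sumTo-+ : ∀ n f g → sumTo n (λ k → f k + g k) ≈ sumTo n f + sumTo n g
  sumTo-+ zero    f g = sym (+-identityʳ 0#)
  sumTo-+ (suc n) f g = trans (+-cong (sumTo-+ n f g) refl) (interchange _ _ _ _)

  sumTo-*ˡ : ∀ n a f → sumTo n (λ k → a * f k) ≈ a * sumTo n f
  sumTo-*ˡ zero    a f = sym (zeroʳ a)
  sumTo-*ˡ (suc n) a f = trans (+-cong (sumTo-*ˡ n a f) refl) (sym (distribˡ a _ _))

  sumTo-vanishes : ∀ n f → (∀ k → k < n → f k ≈ 0#) → sumTo n f ≈ 0#
  sumTo-vanishes zero    f f≈0 = refl
  sumTo-vanishes (suc n) f f≈0 = begin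
    sumTo n f + f n ≈⟨ +-cong (sumTo-vanishes n f (λ k k<n → f≈0 k (m<n⇒m<1+n k<n))) (f≈0 n (n<1+n n)) ⟩
    0# + 0#         ≈⟨ +-identityʳ 0# ⟩
    0#              ∎

  sumTo-dropLast : ∀ n f → f n ≈ 0# → sumTo (suc n) f ≈ sumTo n f
  sumTo-dropLast n f fn≈0 = trans (+-cong refl fn≈0) (+-identityʳ _)

  sumTo-sucˡ : ∀ n f → sumTo (suc n) f ≈ f 0 + sumTo n (λ k → f (suc k))
  sumTo-sucˡ zero    f = trans (+-identityˡ _) (sym (+-identityʳ _))
  sumTo-sucˡ (suc n) f = trans (+-cong (sumTo-sucˡ n f) refl) (+-assoc _ _ _)

  coeff-+P : ∀ p q i → coeff (p +P q) i ≈ coeff p i + coeff q i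
  coeff-+P []      q       i       = sym (+-identityˡ _)
  coeff-+P (a ∷ p) []      zero    = sym (+-identityʳ _)
  coeff-+P (a ∷ p) []      (suc i) = sym (+-identityʳ _)
  coeff-+P (a ∷ p) (b ∷ q) zero    = refl
  coeff-+P (a ∷ p) (b ∷ q) (suc i) = coeff-+P p q i

  coeff-scale : ∀ a p i → coeff (scale a p) i ≈ a * coeff p i
  coeff-scale a []      i       = sym (zeroʳ a)
  coeff-scale a (b ∷ p) zero    = refl
  coeff-scale a (b ∷ p) (suc i) = coeff-scale a p i

  coeff-sumP : ∀ n F i → coeff (sumP n F) i ≈ sumTo n (λ k → coeff (F k) i)
  coeff-sumP zero    F i = refl
  coeff-sumP (suc n) F i = trans (coeff-+P (sumP n F) (F n) i) (+-cong (coeff-sumP n F i) refl)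

  coeff-*P-linear : ∀ p a i → coeff (p *P (X +P const a)) i ≈ a * coeff p i + coeff (0# ∷ p) i
  coeff-*P-linear []      a zero          = sym (trans (+-identityʳ _) (zeroʳ a))
  coeff-*P-linear []      a (suc i)       = sym (trans (+-identityʳ _) (zeroʳ a))
  coeff-*P-linear (b ∷ p) a zero          =
    +-cong (trans (*-cong refl (+-identityˡ a)) (*-comm b a)) refl
  coeff-*P-linear (b ∷ p) a (suc zero)    = begin
    coeff (((b * 1#) ∷ []) +P p *P (X +P const a)) 0 ≈⟨ coeff-+P ((b * 1#) ∷ []) (p *P (X +P const a)) 0 ⟩
    b * 1# + coeff (p *P (X +P const a)) 0          ≈⟨ +-cong (*-identityʳ b) (coeff-*P-linear p a 0) ⟩
    b + (a * coeff p 0 + 0#)                        ≈⟨ +-comm b _ ⟩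
    (a * coeff p 0 + 0#) + b                        ≈⟨ +-cong (+-identityʳ _) refl ⟩
    a * coeff p 0 + b                               ∎
  coeff-*P-linear (b ∷ p) a (suc (suc i)) = begin
    coeff (((b * 1#) ∷ []) +P p *P (X +P const a)) (suc i) ≈⟨ coeff-+P ((b * 1#) ∷ []) (p *P (X +P const a)) (suc i) ⟩
    0# + coeff (p *P (X +P const a)) (suc i)             ≈⟨ +-identityˡ _ ⟩
    coeff (p *P (X +P const a)) (suc i)                  ≈⟨ coeff-*P-linear p a (suc i) ⟩
    a * coeff p (suc i) + coeff p i                      ∎

  coeff-const1-*P : ∀ q i → coeff (const 1# *P q) i ≈ coeff q i
  coeff-const1-*P q i = begin
    coeff (scale 1# q +P (0# ∷ [])) i      ≈⟨ coeff-+P (scale 1# q) _ i ⟩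
    coeff (scale 1# q) i + coeff (0# ∷ []) i ≈⟨ +-cong (trans (coeff-scale 1# q i) (*-identityˡ _)) (zero-coeff i) ⟩
    coeff q i + 0#                         ≈⟨ +-identityʳ _ ⟩
    coeff q i                              ∎
    where
    zero-coeff : ∀ i → coeff (0# ∷ []) i ≈ 0#
    zero-coeff zero    = refl
    zero-coeff (suc i) = refl

  coeff-linear-*P : ∀ a q i → coeff ((X +P const a) *P q) i ≈ a * coeff q i + coeff (0# ∷ q) i
  coeff-linear-*P a q i = trans (coeff-+P (scale (0# + a) q) _ i) (+-cong scaled (shifted i))
    where
    scaled : coeff (scale (0# + a) q) i ≈ a * coeff q i
    scaled = trans (coeff-scale _ q i) (*-cong (+-identityˡ a) refl)
    shifted : ∀ i → coeff (0# ∷ (const 1# *P q)) i ≈ coeff (0# ∷ q) i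
    shifted zero    = refl
    shifted (suc i) = coeff-const1-*P q i

  linProd : (ℕ → Carrier) → ℕ → Pol
  linProd h n = prodP n (λ j → X +P const (h j))

  coeff-linProd-high : ∀ h n i → n < i → coeff (linProd h n) i ≈ 0#
  coeff-linProd-high h zero    (suc i) _         = refl
  coeff-linProd-high h (suc n) (suc i) (s≤s n<i) = begin
    coeff (linProd h n *P (X +P const (h n))) (suc i)  ≈⟨ coeff-*P-linear (linProd h n) (h n) (suc i) ⟩
    h n * coeff (linProd h n) (suc i) + coeff (linProd h n) i
      ≈⟨ +-cong (*-cong refl (coeff-linProd-high h n (suc i) (m<n⇒m<1+n n<i)))
                (coeff-linProd-high h n i n<i) ⟩
    h n * 0# + 0#                                      ≈⟨ trans (+-identityʳ _) (zeroʳ _) ⟩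
    0#                                                 ∎

  coeff-linProd-top : ∀ h n → coeff (linProd h n) n ≈ 1#
  coeff-linProd-top h zero    = refl
  coeff-linProd-top h (suc n) = begin
    coeff (linProd h n *P (X +P const (h n))) (suc n)  ≈⟨ coeff-*P-linear (linProd h n) (h n) (suc n) ⟩
    h n * coeff (linProd h n) (suc n) + coeff (linProd h n) n
      ≈⟨ +-cong (*-cong refl (coeff-linProd-high h n (suc n) (n<1+n n))) (coeff-linProd-top h n) ⟩
    h n * 0# + 1#                                      ≈⟨ trans (+-cong (zeroʳ _) refl) (+-identityˡ _) ⟩
    1#                                                 ∎

  expansionCoeff : (ℕ → Carrier) → ℕ → (ℕ → Carrier) → ℕ → Carrier
  expansionCoeff h N a i = sumTo N (λ k → a k * coeff (linProd h k) i)

  coeff-expansion : ∀ h N a i →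
    coeff (sumP N (λ k → scale (a k) (linProd h k))) i ≈ expansionCoeff h N a i
  coeff-expansion h N a i =
    trans (coeff-sumP N _ i) (sumTo-cong N (λ k → coeff-scale (a k) (linProd h k) i))

  expansionCoeff-top : ∀ h N a → expansionCoeff h (suc N) a N ≈ a N
  expansionCoeff-top h N a = begin
    expansionCoeff h N a N + a N * coeff (linProd h N) N
      ≈⟨ +-cong (sumTo-vanishes N _ (λ k k<N → trans (*-cong refl (coeff-linProd-high h k N k<N)) (zeroʳ _)))
                (*-cong refl (coeff-linProd-top h N)) ⟩
    0# + a N * 1#  ≈⟨ trans (+-identityˡ _) (*-identityʳ _) ⟩
    a N            ∎

  -- the products ∏_{j<k} (x + h_j) are monic of degree k, hence a basis
  expansionCoeff-unique : ∀ h N a b → (∀ i → expansionCoeff h N a i ≈ expansionCoeff h N b i) →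
                          ∀ k → k < N → a k ≈ b k
  expansionCoeff-unique h (suc N) a b a≈b k k<1+N = split (m<1+n⇒m<n∨m≡n k<1+N)
    where
    top : a N ≈ b N
    top = trans (sym (expansionCoeff-top h N a)) (trans (a≈b N) (expansionCoeff-top h N b))
    lower : ∀ i → expansionCoeff h N a i ≈ expansionCoeff h N b i
    lower i = ∙-cancelʳ (a N * coeff (linProd h N) i) _ _
                (trans (a≈b i) (+-cong refl (*-cong (sym top) refl)))
    split : k < N ⊎ k ≡ N → a k ≈ b k
    split (inj₁ k<N)   = expansionCoeff-unique h N a b lower k k<N
    split (inj₂ ≡.refl) = top

  -- coefficient of y^m in p(1/y) · Σ_j G_j y^j, for p of degree < N
  pairing : ℕ → Pol → (ℕ → Carrier) → ℕ → Carrier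
  pairing N p G m = sumTo N (λ i → coeff p i * G (i +ℕ m))

  -- multiplying p by x + a amounts to applying (1/y)(·) + a to the series
  pairing-*P-linear : ∀ d p a G m → coeff p (suc d) ≈ 0# →
    pairing (suc (suc d)) (p *P (X +P const a)) G m ≈ pairing (suc d) p (λ j → G (suc j) + a * G j) m
  pairing-*P-linear d p a G m deg = begin
    pairing (suc (suc d)) (p *P (X +P const a)) G m
      ≈⟨ sumTo-cong (suc (suc d)) (λ i → trans (*-cong (coeff-*P-linear p a i) refl) (distribʳ _ _ _)) ⟩
    sumTo (suc (suc d)) (λ i → a * coeff p i * G (i +ℕ m) + coeff (0# ∷ p) i * G (i +ℕ m))
      ≈⟨ sumTo-+ (suc (suc d)) _ _ ⟩
    sumTo (suc (suc d)) (λ i → a * coeff p i * G (i +ℕ m)) + sumTo (suc (suc d)) (λ i → coeff (0# ∷ p) i * G (i +ℕ m))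
      ≈⟨ +-cong (sumTo-dropLast (suc d) _ (trans (*-cong (*-cong refl deg) refl) (trans (*-cong (zeroʳ a) refl) (zeroˡ _))))
                (trans (sumTo-sucˡ (suc d) _) (trans (+-cong (zeroˡ _) refl) (+-identityˡ _))) ⟩
    sumTo (suc d) (λ i → a * coeff p i * G (i +ℕ m)) + sumTo (suc d) (λ i → coeff p i * G (suc i +ℕ m))
      ≈⟨ sumTo-+ (suc d) _ _ ⟨
    sumTo (suc d) (λ i → a * coeff p i * G (i +ℕ m) + coeff p i * G (suc i +ℕ m))
      ≈⟨ sumTo-cong (suc d) (λ i → regroup a (coeff p i) (G (i +ℕ m)) (G (suc i +ℕ m))) ⟩
    pairing (suc d) p (λ j → G (suc j) + a * G j) m
      ∎
    where
    regroup : ∀ a p g g′ → a * p * g + p * g′ ≈ p * (g′ + a * g)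
    regroup = solve 4 (λ a p g g′ → a :* p :* g :+ p :* g′ := p :* (g′ :+ a :* g)) refl

  linProd-inverse : ∀ h (F : ℕ → ℕ → Carrier) → (∀ m → F 0 m ≈ δ₀ m) →
    (∀ n j → F (suc n) (suc j) + h n * F (suc n) j ≈ F n j) →
    ∀ n m → pairing (suc n) (linProd h n) (F n) m ≈ δ₀ m
  linProd-inverse h F F₀ step zero    m = trans (+-identityˡ _) (trans (*-identityˡ _) (F₀ m))
  linProd-inverse h F F₀ step (suc n) m = begin
    pairing (suc (suc n)) (linProd h (suc n)) (F (suc n)) m
      ≈⟨ pairing-*P-linear n (linProd h n) (h n) (F (suc n)) m (coeff-linProd-high h n (suc n) (n<1+n n)) ⟩
    pairing (suc n) (linProd h n) (λ j → F (suc n) (suc j) + h n * F (suc n) j) m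
      ≈⟨ sumTo-cong (suc n) (λ i → *-cong refl (step n (i +ℕ m))) ⟩
    pairing (suc n) (linProd h n) (F n) m
      ≈⟨ linProd-inverse h F F₀ step n m ⟩
    δ₀ m
      ∎

module LamRStirlingSeries {c ℓ : Level} (R : CommutativeRing c ℓ)
  (lam : CommutativeRing.Carrier R) (r : ℕ) (S : ℕ → ℕ → CommutativeRing.Carrier R)
  (isS : Poly.IsLamRStirling R lam r S) where

  open CommutativeRing R hiding (zero)
  open Poly R
  open PolyProperties R
  open import Relation.Binary.Reasoning.Setoid setoid
  open import Algebra.Properties.Ring ring using (-‿distribˡ-*)
  open import Algebra.Solver.Ring.NaturalCoefficients.Default commutativeSemiring

  -- fallλ lam k = linProd fallShift k and denom lam r k = linProd shift (suc k)
  fallShift shift : ℕ → Carrier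
  fallShift j = - (ι j * lam)
  shift     j = ι r + ι j * lam

  fall : ℕ → Pol
  fall = linProd fallShift

  S-vanishes : ∀ n k → n < k → S n k ≈ 0#
  S-vanishes = proj₂ isS

  coeff-power : ∀ n i → coeff ((X +P const (ι r)) ^P n) i ≈ expansionCoeff fallShift (suc n) (S n) i
  coeff-power n i = trans (proj₁ isS n i) (coeff-expansion fallShift (suc n) (S n) i)

  coeff-x*power : ∀ n i →
    coeff (0# ∷ (X +P const (ι r)) ^P n) i ≈ sumTo (suc n) (λ k → S n k * coeff (0# ∷ fall k) i)
  coeff-x*power n zero    = sym (sumTo-vanishes (suc n) _ (λ k _ → zeroʳ (S n k)))
  coeff-x*power n (suc i) = coeff-power n i

  S-zero-zero : S 0 0 ≈ 1#
  S-zero-zero = sym (trans (coeff-power 0 0) (trans (+-identityˡ _) (*-identityʳ _)))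

  coeff-linear-*-fall : ∀ k i →
    ι r * coeff (fall k) i + coeff (0# ∷ fall k) i ≈ shift k * coeff (fall k) i + coeff (fall (suc k)) i
  coeff-linear-*-fall k i = begin
    ι r * coeff (fall k) i + coeff (0# ∷ fall k) i
      ≈⟨ +-cong (*-cong r≈shift+fallShift refl) refl ⟩
    (shift k + fallShift k) * coeff (fall k) i + coeff (0# ∷ fall k) i
      ≈⟨ trans (+-cong (distribʳ _ _ _) refl) (+-assoc _ _ _) ⟩
    shift k * coeff (fall k) i + (fallShift k * coeff (fall k) i + coeff (0# ∷ fall k) i)
      ≈⟨ +-cong refl (coeff-*P-linear (fall k) (fallShift k) i) ⟨
    shift k * coeff (fall k) i + coeff (fall (suc k)) i
      ∎
    where
    r≈shift+fallShift : ι r ≈ shift k + fallShift k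
    r≈shift+fallShift = sym (trans (+-assoc _ _ _) (trans (+-cong refl (-‿inverseʳ _)) (+-identityʳ _)))

  prevS : ℕ → ℕ → Carrier
  prevS n zero    = 0#
  prevS n (suc k) = S n k

  power-suc-expansion : ∀ n i →
    expansionCoeff fallShift (suc (suc n)) (S (suc n)) i ≈
    expansionCoeff fallShift (suc (suc n)) (λ k → prevS n k + shift k * S n k) i
  power-suc-expansion n i = begin
    expansionCoeff fallShift (suc (suc n)) (S (suc n)) i
      ≈⟨ coeff-power (suc n) i ⟨
    coeff ((X +P const (ι r)) *P (X +P const (ι r)) ^P n) i
      ≈⟨ coeff-linear-*P (ι r) ((X +P const (ι r)) ^P n) i ⟩
    ι r * coeff ((X +P const (ι r)) ^P n) i + coeff (0# ∷ (X +P const (ι r)) ^P n) i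
      ≈⟨ +-cong (trans (*-cong refl (coeff-power n i)) (sym (sumTo-*ˡ (suc n) (ι r) _))) (coeff-x*power n i) ⟩
    sumTo (suc n) (λ k → ι r * (S n k * f k)) + sumTo (suc n) (λ k → S n k * coeff (0# ∷ fall k) i)
      ≈⟨ sumTo-+ (suc n) _ _ ⟨
    sumTo (suc n) (λ k → ι r * (S n k * f k) + S n k * coeff (0# ∷ fall k) i)
      ≈⟨ sumTo-cong (suc n) step ⟩
    sumTo (suc n) (λ k → S n k * f (suc k) + shift k * S n k * f k)
      ≈⟨ sumTo-+ (suc n) _ _ ⟩
    sumTo (suc n) (λ k → S n k * f (suc k)) + sumTo (suc n) (λ k → shift k * S n k * f k)
      ≈⟨ +-cong (trans (sumTo-sucˡ (suc n) _) (trans (+-cong (zeroˡ _) refl) (+-identityˡ _)))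
                (sumTo-dropLast (suc n) _ (trans (*-cong (*-cong refl (S-vanishes n (suc n) (n<1+n n))) refl)
                                                 (trans (*-cong (zeroʳ _) refl) (zeroˡ _)))) ⟨
    sumTo (suc (suc n)) (λ k → prevS n k * f k) + sumTo (suc (suc n)) (λ k → shift k * S n k * f k)
      ≈⟨ sumTo-+ (suc (suc n)) _ _ ⟨
    sumTo (suc (suc n)) (λ k → prevS n k * f k + shift k * S n k * f k)
      ≈⟨ sumTo-cong (suc (suc n)) (λ k → sym (distribʳ _ _ _)) ⟩
    expansionCoeff fallShift (suc (suc n)) (λ k → prevS n k + shift k * S n k) i
      ∎
    where
    f : ℕ → Carrier
    f k = coeff (fall k) i
    step : ∀ k → ι r * (S n k * f k) + S n k * coeff (0# ∷ fall k) i ≈ S n k * f (suc k) + shift k * S n k * f k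
    step k = begin
      ι r * (S n k * f k) + S n k * coeff (0# ∷ fall k) i
        ≈⟨ solve 4 (λ ρ s f g → ρ :* (s :* f) :+ s :* g := s :* (ρ :* f :+ g)) refl _ _ _ _ ⟩
      S n k * (ι r * f k + coeff (0# ∷ fall k) i)
        ≈⟨ *-cong refl (coeff-linear-*-fall k i) ⟩
      S n k * (shift k * f k + f (suc k))
        ≈⟨ solve 4 (λ s c f f′ → s :* (c :* f :+ f′) := s :* f′ :+ c :* s :* f) refl _ _ _ _ ⟩
      S n k * f (suc k) + shift k * S n k * f k
        ∎

  S-suc : ∀ n k → S (suc n) k ≈ prevS n k + shift k * S n k
  S-suc n k with k <? suc (suc n)
  ... | yes k<2+n = expansionCoeff-unique fallShift (suc (suc n)) _ _ (power-suc-expansion n) k k<2+n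
  ... | no  k≮2+n = begin
    S (suc n) k                ≈⟨ S-vanishes (suc n) k 1+n<k ⟩
    0#                         ≈⟨ trans (+-identityˡ _) (zeroʳ (shift k)) ⟨
    0# + shift k * 0#          ≈⟨ +-cong (prevS-vanishes k 1+n<k) (*-cong refl (S-vanishes n k (<-trans (n<1+n n) 1+n<k))) ⟨
    prevS n k + shift k * S n k ∎
    where
    1+n<k : suc n < k
    1+n<k = ≮⇒≥ k≮2+n
    prevS-vanishes : ∀ k → suc n < k → prevS n k ≈ 0#
    prevS-vanishes (suc k) (s≤s n<k) = S-vanishes n k n<k

  -- series k j is the coefficient of (1/x)^j in 1 / ((x + r)(x + r + λ)⋯(x + r + (k-1)λ))
  series : ℕ → ℕ → Carrier
  series zero    = δ₀
  series (suc k) = rhsCoeff k S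

  rhsCoeff-suc : ∀ k n → rhsCoeff k S (suc n) ≈ sgn (n ∸ k) * S n k
  rhsCoeff-suc k n with k ≤? n
  ... | yes _   = refl
  ... | no  k≰n = sym (trans (*-cong refl (S-vanishes n k (≰⇒> k≰n))) (zeroʳ _))

  sgn-suc-cancel : ∀ m y → sgn (suc m) * y + sgn m * y ≈ 0#
  sgn-suc-cancel m y = trans (+-cong (sym (-‿distribˡ-* (sgn m) y)) refl) (-‿inverseˡ _)

  sgn-cancel : ∀ J k → sgn (J ∸ k) * S J (suc k) + sgn (J ∸ suc k) * S J (suc k) ≈ 0#
  sgn-cancel J k with k <? J
  -- for k < J the two signs are opposite, since J ∸ k ≡ suc (J ∸ suc k)
  ... | yes k<J rewrite +-∸-assoc 1 k<J = sgn-suc-cancel (J ∸ suc k) (S J (suc k))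
  ... | no  k≮J = begin
    sgn (J ∸ k) * S J (suc k) + sgn (J ∸ suc k) * S J (suc k) ≈⟨ +-cong (*-cong refl S≈0) (*-cong refl S≈0) ⟩
    sgn (J ∸ k) * 0# + sgn (J ∸ suc k) * 0#                   ≈⟨ +-cong (zeroʳ _) (zeroʳ _) ⟩
    0# + 0#                                                   ≈⟨ +-identityʳ 0# ⟩
    0#                                                        ∎
    where
    S≈0 : S J (suc k) ≈ 0#
    S≈0 = S-vanishes J (suc k) (s≤s (≮⇒≥ k≮J))

  regroup : ∀ s a c t s′ → s * (a + c * t) + c * (s′ * t) ≈ s * a + c * (s * t + s′ * t)
  regroup = solve 5 (λ s a c t s′ → s :* (a :+ c :* t) :+ c :* (s′ :* t) := s :* a :+ c :* (s :* t :+ s′ :* t)) refl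

  series-step : ∀ n j → series (suc n) (suc j) + shift n * series (suc n) j ≈ series n j
  series-step zero zero = begin
    rhsCoeff 0 S 1 + shift 0 * 0# ≈⟨ +-cong (rhsCoeff-suc 0 0) (zeroʳ _) ⟩
    1# * S 0 0 + 0#               ≈⟨ trans (+-identityʳ _) (*-identityˡ _) ⟩
    S 0 0                         ≈⟨ S-zero-zero ⟩
    1#                            ∎
  series-step zero (suc J) = begin
    rhsCoeff 0 S (suc (suc J)) + shift 0 * rhsCoeff 0 S (suc J)
      ≈⟨ +-cong (trans (rhsCoeff-suc 0 (suc J)) (*-cong refl (S-suc J 0))) (*-cong refl (rhsCoeff-suc 0 J)) ⟩
    sgn (suc J) * (0# + shift 0 * S J 0) + shift 0 * (sgn J * S J 0)
      ≈⟨ regroup _ _ _ _ _ ⟩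
    sgn (suc J) * 0# + shift 0 * (sgn (suc J) * S J 0 + sgn J * S J 0)
      ≈⟨ +-cong (zeroʳ _) (trans (*-cong refl (sgn-suc-cancel J (S J 0))) (zeroʳ _)) ⟩
    0# + 0#
      ≈⟨ +-identityʳ 0# ⟩
    0#
      ∎
  series-step (suc k) zero = begin
    rhsCoeff (suc k) S 1 + shift (suc k) * 0# ≈⟨ +-cong (rhsCoeff-suc (suc k) 0) (zeroʳ _) ⟩
    1# * S 0 (suc k) + 0#                    ≈⟨ trans (+-identityʳ _) (*-identityˡ _) ⟩
    S 0 (suc k)                              ≈⟨ S-vanishes 0 (suc k) (s≤s z≤n) ⟩
    0#                                       ∎
  series-step (suc k) (suc J) = begin
    rhsCoeff (suc k) S (suc (suc J)) + shift (suc k) * rhsCoeff (suc k) S (suc J)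
      ≈⟨ +-cong (trans (rhsCoeff-suc (suc k) (suc J)) (*-cong refl (S-suc J (suc k))))
                (*-cong refl (rhsCoeff-suc (suc k) J)) ⟩
    sgn (J ∸ k) * (S J k + shift (suc k) * S J (suc k)) + shift (suc k) * (sgn (J ∸ suc k) * S J (suc k))
      ≈⟨ regroup _ _ _ _ _ ⟩
    sgn (J ∸ k) * S J k + shift (suc k) * (sgn (J ∸ k) * S J (suc k) + sgn (J ∸ suc k) * S J (suc k))
      ≈⟨ +-cong refl (trans (*-cong refl (sgn-cancel J k)) (zeroʳ _)) ⟩
    sgn (J ∸ k) * S J k + 0#
      ≈⟨ trans (+-identityʳ _) (sym (rhsCoeff-suc k J)) ⟩
    rhsCoeff k S (suc J)
      ∎

theorem8 : ∀ {c ℓ : Level} (R : CommutativeRing c ℓ) →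
    let open CommutativeRing R in
    let open Poly R in
    (lam : Carrier) (r k : ℕ) (S : ℕ → ℕ → Carrier) →
    IsLamRStirling lam r S →
    ∀ m → sumTo (suc (suc k)) (λ i → coeff (denom lam r k) i * rhsCoeff k S (i Data.Nat.+ m)) ≈ δ₀ m
theorem8 R lam r k S isS m =
  linProd-inverse shift series (λ _ → refl) series-step (suc k) m
  where
  open CommutativeRing R using (refl)
  open PolyProperties R using (linProd-inverse)
  open LamRStirlingSeries R lam r S isS using (shift; series; series-step)
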